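{- Let $h>0$ and $\alpha>0$ be integers and $\lambda\vdash h+\alpha$. Then the maps $\varphi_{\lambda,h,\alpha}:\operatorname{SYT}_{h,\alpha}(\lambda)\to\operatorname{SYT}_{h,\alpha-1}(\lambda)$ and $\phi_{\lambda,h,\alpha}:\operatorname{SYT}_{h,\alpha-1}(\lambda)\to\operatorname{SYT}_{h,\alpha}(\lambda)$ defined below are mutually inverse bijections.
   Context: For a partition $\lambda\vdash k$, its diagram has boxes $(i,j)$, $1\le i\le\ell(\lambda)$, $1\le j\le\lambda_i$ (row $i$ from the top). $\operatorname{SYT}(\lambda)$ is the set of standard Young tableaux of shape $\lambda$ (bijective fillings with $1,\ldots,k$ increasing along rows and down columns). For a tableau $T$, $R_T(m)$, $C_T(m)$ are the row and column of the box containing $m$, and $v_T(m)=(R_T(m),C_T(m))$. For $0\le h\le k$, $0\le\alpha\le k-h$, $\operatorname{SYT}_{h,\alpha}(\lambda)$ is the set of $T\in\operatorname{SYT}(\lambda)$ with $R_T(i+1+\alpha)>R_T(i+\alpha)$ for all $1\le i<h$. With $\lambda\vdash h+\alpha$: the map $\varphi_{\lambda,h,\alpha}$ on $\operatorname{SYT}_{h,\alpha}(\lambda)$ is the identity on $\operatorname{SYT}_{h,\alpha}(\lambda)\cap\operatorname{SYT}_{h,\alpha-1}(\lambda)$; for other $T$, let $q:=\max\{1\le i\le h: R_T(i+\alpha)\le R_T(\alpha)\}$, and $\varphi_{\lambda,h,\alpha}(T)$ places $m$ in $v_T(m)$ if $1\le m\le\alpha-1$, in $v_T(m+1)$ if $\alpha\le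 m\le q-2+\alpha$ or $q+\alpha\le m\le h-1+\alpha$, in $v_T(\alpha)$ if $m=q-1+\alpha$, and in $v_T(q+\alpha)$ if $m=h+\alpha$. The map $\phi_{\lambda,h,\alpha}$ on $\operatorname{SYT}_{h,\alpha-1}(\lambda)$ is the identity on $\operatorname{SYT}_{h,\alpha}(\lambda)\cap\operatorname{SYT}_{h,\alpha-1}(\lambda)$; for other $T$, let $p:=\min\{0\le i\le h-1: R_T(h+\alpha)\le R_T(i+\alpha)\}$, and $\phi_{\lambda,h,\alpha}(T)$ places $m$ in $v_T(m)$ if $1\le m\le\alpha-1$, in $v_T(m-1)$ if $1+\alpha\le m\le p+\alpha$ or $p+2+\alpha\le m\le h+\alpha$, in $v_T(h+\alpha)$ if $m=p+1+\alpha$, and in $v_T(p+\alpha)$ if $m=\alpha$. It is known that $\varphi_{\lambda,h,\alpha}$ takes values in $\operatorname{SYT}_{h,\alpha-1}(\lambda)$ and $\phi_{\lambda,h,\alpha}$ takes values in $\operatorname{SYT}_{h,\alpha}(\lambda)$. -}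

module Defs where

open import Data.Nat using (ℕ; zero; suc; _+_; _∸_; _≤_; _<_; _≥_; _≤ᵇ_; _≡ᵇ_; _<ᵇ_)
open import Data.Bool using (Bool; true; false; if_then_else_)
open import Data.List using (List; []; _∷_)
open import Data.Nat.ListAction using (sum)
open import Data.List.Relation.Unary.All using (All)
open import Data.List.Relation.Unary.Linked using (Linked)
open import Data.Product using (_×_; _,_; proj₁; proj₂; ∃-syntax)
open import Relation.Binary.PropositionalEquality using (_≡_)

IsPartition : ℕ → List ℕ → Set
IsPartition n ls = Linked _≥_ ls × All (0 <_) ls × sum ls ≡ n

-- length of row i (rows numbered from 1); 0 outside the diagram
rowLen : List ℕ → ℕ → ℕ
rowLen []       _             = 0
rowLen (x ∷ xs) zero          = 0
rowLen (x ∷ xs) (suc zero)    = x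
rowLen (x ∷ xs) (suc (suc i)) = rowLen xs (suc i)

Box : List ℕ → ℕ × ℕ → Set
Box ls (i , j) = 1 ≤ i × 1 ≤ j × j ≤ rowLen ls i

-- A tableau T is represented by its position map m ↦ v_T(m) = (R_T(m), C_T(m)),
-- meaningful for 1 ≤ m ≤ k (values elsewhere are irrelevant).
Tab : Set
Tab = ℕ → ℕ × ℕ

R : Tab → ℕ → ℕ
R T m = proj₁ (T m)

C : Tab → ℕ → ℕ
C T m = proj₂ (T m)

SYT : List ℕ → ℕ → Tab → Set
SYT ls k T =
  (∀ m → 1 ≤ m → m ≤ k → Box ls (T m)) ×
  (∀ m m' → 1 ≤ m → m ≤ k → 1 ≤ m' → m' ≤ k → T m ≡ T m' → m ≡ m') ×
  (∀ b → Box ls b → ∃[ m ] (1 ≤ m × m ≤ k × T m ≡ b)) ×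
  (∀ m m' → 1 ≤ m → m ≤ k → 1 ≤ m' → m' ≤ k →
     R T m ≡ R T m' → C T m < C T m' → m < m') ×
  (∀ m m' → 1 ≤ m → m ≤ k → 1 ≤ m' → m' ≤ k →
     C T m ≡ C T m' → R T m < R T m' → m < m')

from1 : ℕ → List ℕ
from1 zero    = []
from1 (suc n) = Data.List._++_ (from1 n) (suc n ∷ [])

Chain : Tab → ℕ → ℕ → Set
Chain T h a = All (λ i → R T (i + a) < R T (suc i + a)) (from1 (h ∸ 1))

chainᵇ : Tab → ℕ → ℕ → Bool
chainᵇ T h a = go (h ∸ 1)
  where
  go : ℕ → Bool
  go zero    = true
  go (suc i) = if R T (suc i + a) <ᵇ R T (suc (suc i) + a) then go i else false

SYTh : List ℕ → ℕ → ℕ → ℕ → Tab → Set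
SYTh ls k h a T = SYT ls k T × Chain T h a

-- largest i with 1 ≤ i ≤ n and P i (0 if none)
maxSat : (ℕ → Bool) → ℕ → ℕ
maxSat P zero    = 0
maxSat P (suc n) = if P (suc n) then suc n else maxSat P n

-- least i with i₀ ≤ i < i₀ + n and P i (0 if none)
minFrom : (ℕ → Bool) → ℕ → ℕ → ℕ
minFrom P i zero    = 0
minFrom P i (suc n) = if P i then i else minFrom P (suc i) n

_∧_ : Bool → Bool → Bool
true ∧ b = b
false ∧ b = false

varphi : List ℕ → ℕ → ℕ → Tab → Tab
varphi ls h α T m =
  if chainᵇ T h α ∧ chainᵇ T h (α ∸ 1) then T m else new
  where
  q : ℕ
  q = maxSat (λ i → R T (i + α) ≤ᵇ R T α) h
  new : ℕ × ℕ
  new = if m <ᵇ α then T m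
        else if m ≡ᵇ (q + α ∸ 1) then T α
        else if m ≡ᵇ (h + α) then T (q + α)
        else if m ≤ᵇ (h + α ∸ 1) then T (suc m)
        else T m

phi : List ℕ → ℕ → ℕ → Tab → Tab
phi ls h α T m =
  if chainᵇ T h α ∧ chainᵇ T h (α ∸ 1) then T m else new
  where
  p : ℕ
  p = minFrom (λ i → R T (h + α) ≤ᵇ R T (i + α)) 0 h
  new : ℕ × ℕ
  new = if m <ᵇ α then T m
        else if m ≡ᵇ α then T (p + α)
        else if m ≡ᵇ (suc p + α) then T (h + α)
        else if m ≤ᵇ (h + α) then T (m ∸ 1)
        else T m

module Submission where

-- If T lies in both SYT_{h,α} and SYT_{h,α-1}, both maps fix it. Otherwise each map moves the
-- entries of T by a permutation: φ rotates the blocks [α, q-1+α] and [q+α, h+α] one step, ϕ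
-- rotates [α, p+α] and [p+α+1, h+α] one step back. Three facts make the maps inverse.
-- (1) The moved tableau is standard: the pairs whose order is reversed lie in different rows,
-- since rows strictly increase along the chain, and in different columns, since otherwise two boxes
-- of one row (directly below α and below s, resp. directly above P and above h+α) would be filled
-- in the wrong order. (2) The image satisfies the other chain condition but not the original one,
-- so the second map also acts by a rotation. (3) The cut point it computes (p for ϕ, q for φ)
-- is the old one, so that rotation is the inverse.

open import Defs
open import Data.Bool using (Bool; true; false; if_then_else_)
open import Data.Empty using (⊥; ⊥-elim)
open import Data.List using (List; []; _∷_)
open import Data.List.Relation.Unary.All as All using (All; []; _∷_)
open import Data.List.Relation.Unary.All.Properties using (++⁺; ++⁻ˡ; ++⁻ʳ)
open import Data.List.Relation.Unary.Linked as Linked using (Linked; []; _∷_)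
open import Data.Nat
open import Data.Nat.Properties
open import Data.Product using (_×_; _,_; proj₁; proj₂; ∃-syntax)
open import Data.Sum using (_⊎_; inj₁; inj₂)
open import Function using (_∘_; id)
open import Relation.Binary.Definitions using (tri<; tri≈; tri>)
open import Relation.Binary.PropositionalEquality
open import Relation.Nullary using (¬_; Dec; yes; no; _because_)
open import Relation.Nullary.Reflects using (Reflects; ofʸ; ofⁿ; det; fromEquivalence)

-- A record rather than a function type, so that the tableau can be inferred from a proof.
record RowsIncreasing (t : Tab) (lo hi : ℕ) : Set where
  constructor rowsIncreasing
  field step : ∀ m → lo ≤ m → suc m ≤ hi → R t m < R t (suc m)
open RowsIncreasing

module _ {t : Tab} {lo hi : ℕ} (inc : RowsIncreasing t lo hi) where

  RowsIncreasing-< : ∀ {x y} → lo ≤ x → x < y → y ≤ hi → R t x < R t y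
  RowsIncreasing-< {x} {suc y} lo≤x (s≤s x≤y) 1+y≤hi with m≤n⇒m<n∨m≡n x≤y
  ... | inj₂ refl = step inc x lo≤x 1+y≤hi
  ... | inj₁ x<y  =
    <-trans (RowsIncreasing-< lo≤x x<y (<⇒≤ 1+y≤hi)) (step inc y (≤-trans lo≤x x≤y) 1+y≤hi)

  RowsIncreasing-≤ : ∀ {x y} → lo ≤ x → x ≤ y → y ≤ hi → R t x ≤ R t y
  RowsIncreasing-≤ lo≤x x≤y y≤hi with m≤n⇒m<n∨m≡n x≤y
  ... | inj₂ refl = ≤-refl
  ... | inj₁ x<y  = <⇒≤ (RowsIncreasing-< lo≤x x<y y≤hi)

  RowsIncreasing-⊆ : ∀ {lo′ hi′} → lo ≤ lo′ → hi′ ≤ hi → RowsIncreasing t lo′ hi′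
  RowsIncreasing-⊆ lo≤lo′ hi′≤hi =
    rowsIncreasing λ m lo′≤m 1+m≤hi′ → step inc m (≤-trans lo≤lo′ lo′≤m) (≤-trans 1+m≤hi′ hi′≤hi)

RowsIncreasing-extendˡ : ∀ {t lo hi} → R t lo < R t (suc lo) → RowsIncreasing t (suc lo) hi →
  RowsIncreasing t lo hi
RowsIncreasing-extendˡ {t} {lo} {hi} first inc = rowsIncreasing extended
  where
  extended : ∀ m → lo ≤ m → suc m ≤ hi → R t m < R t (suc m)
  extended m lo≤m 1+m≤hi with m≤n⇒m<n∨m≡n lo≤m
  ... | inj₂ refl = first
  ... | inj₁ lo<m = step inc m lo<m 1+m≤hi

RowsIncreasing-extendʳ : ∀ {t lo hi} → R t hi < R t (suc hi) → RowsIncreasing t lo hi →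
  RowsIncreasing t lo (suc hi)
RowsIncreasing-extendʳ {t} {lo} {hi} final inc = rowsIncreasing extended
  where
  extended : ∀ m → lo ≤ m → suc m ≤ suc hi → R t m < R t (suc m)
  extended m lo≤m 1+m≤1+hi with m≤n⇒m<n∨m≡n (≤-pred 1+m≤1+hi)
  ... | inj₂ refl = final
  ... | inj₁ m<hi = step inc m lo≤m m<hi

All-from1⁻ : ∀ {P : ℕ → Set} {n} → All P (from1 n) → ∀ {i} → 1 ≤ i → i ≤ n → P i
All-from1⁻ {n = zero}  _   1≤i i≤0 = ⊥-elim (<⇒≱ 1≤i i≤0)
All-from1⁻ {n = suc n} all {i} 1≤i i≤1+n with m≤n⇒m<n∨m≡n i≤1+n
... | inj₂ refl = All.head (++⁻ʳ (from1 n) all)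
... | inj₁ i<1+n = All-from1⁻ (++⁻ˡ (from1 n) all) 1≤i (≤-pred i<1+n)

All-from1⁺ : ∀ {P : ℕ → Set} n → (∀ {i} → 1 ≤ i → i ≤ n → P i) → All P (from1 n)
All-from1⁺ zero    _  = []
All-from1⁺ (suc n) pi = ++⁺ (All-from1⁺ n λ 1≤i i≤n → pi 1≤i (m≤n⇒m≤1+n i≤n)) (pi (s≤s z≤n) ≤-refl ∷ [])

Chain⇒RowsIncreasing : ∀ {t n b} → Chain t (suc n) b → RowsIncreasing t (suc b) (suc n + b)
Chain⇒RowsIncreasing {t} {n} {b} chain = rowsIncreasing λ m b<m 1+m≤1+n+b →
  subst (λ x → R t x < R t (suc x)) (i+b≡m b<m) (All-from1⁻ chain (1≤i b<m) (i≤n b<m 1+m≤1+n+b))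
  where
  i+b≡m : ∀ {m} → b < m → m ∸ b + b ≡ m
  i+b≡m b<m = m∸n+n≡m (<⇒≤ b<m)
  1≤i : ∀ {m} → b < m → 1 ≤ m ∸ b
  1≤i = m<n⇒0<n∸m
  i≤n : ∀ {m} → b < m → suc m ≤ suc n + b → m ∸ b ≤ n
  i≤n {m} b<m 1+m≤1+n+b = +-cancelʳ-≤ b (m ∸ b) n (subst (_≤ n + b) (sym (i+b≡m b<m)) (≤-pred 1+m≤1+n+b))

RowsIncreasing⇒Chain : ∀ {t n b} → RowsIncreasing t (suc b) (suc n + b) → Chain t (suc n) b
RowsIncreasing⇒Chain {n = n} {b} inc =
  All-from1⁺ n λ {i} 1≤i i≤n → step inc (i + b) (+-monoˡ-≤ b 1≤i) (s≤s (+-monoˡ-≤ b i≤n))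

Chain-reflects : ∀ t n b → Reflects (Chain t (suc n) b) (chainᵇ t (suc n) b)
Chain-reflects t zero    b = ofʸ []
Chain-reflects t (suc n) b
  with R t (suc n + b) <ᵇ R t (suc (suc n) + b) | <ᵇ-reflects-< (R t (suc n + b)) (R t (suc (suc n) + b))
... | false | ofⁿ ¬step = ofⁿ (¬step ∘ All.head ∘ ++⁻ʳ (from1 n))
-- The local recursion of chainᵇ ignores its h argument, so chainᵇ t (suc n) b is the recursive call.
... | true  | ofʸ step = extend (Chain-reflects t n b)
  where
  extend : ∀ {c} → Reflects (Chain t (suc n) b) c → Reflects (Chain t (suc (suc n)) b) c
  extend (ofʸ chain)  = ofʸ (++⁺ chain (step ∷ []))
  extend (ofⁿ ¬chain) = ofⁿ (¬chain ∘ ++⁻ˡ (from1 n))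

Chain-cong : ∀ {t} u {h b} → (∀ x → u x ≡ t x) → Chain t h b → Chain u h b
Chain-cong {t} u {b = b} u≗t =
  All.map λ {i} step → subst₂ _<_ (cong proj₁ (sym (u≗t (i + b)))) (cong proj₁ (sym (u≗t (suc i + b)))) step

module _ {A : ℕ → Set} {p : ℕ → Bool} (p-reflects : ∀ i → Reflects (A i) (p i)) where

  maxSat-greatest : A 1 → ∀ n → 1 ≤ n →
    ∃[ q ] (maxSat p n ≡ suc q × suc q ≤ n × A (suc q) × (∀ {i} → suc q < i → i ≤ n → ¬ A i))
  maxSat-greatest a₁ (suc n) _ with p (suc n) | p-reflects (suc n)
  ... | true  | ofʸ a = n , refl , ≤-refl , a , λ n<i i≤n → ⊥-elim (<⇒≱ n<i i≤n)
  ... | false | ofⁿ ¬a with n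
  ...   | zero   = ⊥-elim (¬a a₁)
  ...   | suc n′ with maxSat-greatest a₁ (suc n′) (s≤s z≤n)
  ...     | q , eq , q≤n , aq , above = q , eq , m≤n⇒m≤1+n q≤n , aq , above′
    where
    above′ : ∀ {i} → suc q < i → i ≤ suc (suc n′) → ¬ A i
    above′ q<i i≤2+n with m≤n⇒m<n∨m≡n i≤2+n
    ... | inj₂ refl  = ¬a
    ... | inj₁ i<2+n = above q<i (≤-pred i<2+n)

  maxSat-unique : ∀ n {q} → 1 ≤ q → q ≤ n → A q → (∀ {i} → q < i → i ≤ n → ¬ A i) → maxSat p n ≡ q
  maxSat-unique zero    1≤q q≤0 _ _ = ⊥-elim (<⇒≱ 1≤q q≤0)
  maxSat-unique (suc n) 1≤q q≤1+n aq above with m≤n⇒m<n∨m≡n q≤1+n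
  ... | inj₂ refl rewrite det (p-reflects (suc n)) (ofʸ aq) = refl
  ... | inj₁ q<1+n rewrite det (p-reflects (suc n)) (ofⁿ (above q<1+n ≤-refl)) =
    maxSat-unique n 1≤q (≤-pred q<1+n) aq λ q<i i≤n → above q<i (m≤n⇒m≤1+n i≤n)

  minFrom-least : ∀ n {i j} → i ≤ j → j < i + n → A j →
    i ≤ minFrom p i n × minFrom p i n < i + n × A (minFrom p i n) ×
    (∀ {l} → i ≤ l → l < minFrom p i n → ¬ A l)
  minFrom-least zero    {i} i≤j j<i+0 _ = ⊥-elim (<⇒≱ j<i+0 (subst (_≤ _) (sym (+-identityʳ i)) i≤j))
  minFrom-least (suc n) {i} {j} i≤j j<i+1+n aj with p i | p-reflects i
  ... | true  | ofʸ ai = ≤-refl , m<m+n i (s≤s z≤n) , ai , λ i≤l l<i → ⊥-elim (<⇒≱ l<i i≤l)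
  ... | false | ofⁿ ¬ai with m≤n⇒m<n∨m≡n i≤j
  ...   | inj₂ refl = ⊥-elim (¬ai aj)
  ...   | inj₁ i<j with minFrom-least n i<j (subst (j <_) (+-suc i n) j<i+1+n) aj
  ...     | i<min , min<1+i+n , amin , below =
    <⇒≤ i<min , subst (minFrom p (suc i) n <_) (sym (+-suc i n)) min<1+i+n , amin , below′
    where
    below′ : ∀ {l} → i ≤ l → l < minFrom p (suc i) n → ¬ A l
    below′ i≤l l<min with m≤n⇒m<n∨m≡n i≤l
    ... | inj₂ refl = ¬ai
    ... | inj₁ i<l  = below i<l l<min

  minFrom-unique : ∀ n {i j} → i ≤ j → j < i + n → A j → (∀ {l} → i ≤ l → l < j → ¬ A l) → minFrom p i n ≡ j
  minFrom-unique zero    {i} i≤j j<i+0 _ _ = ⊥-elim (<⇒≱ j<i+0 (subst (_≤ _) (sym (+-identityʳ i)) i≤j))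
  minFrom-unique (suc n) {i} {j} i≤j j<i+1+n aj below with m≤n⇒m<n∨m≡n i≤j
  ... | inj₂ refl rewrite det (p-reflects i) (ofʸ aj) = refl
  ... | inj₁ i<j  rewrite det (p-reflects i) (ofⁿ (below ≤-refl i<j)) =
    minFrom-unique n i<j (subst (j <_) (+-suc i n) j<i+1+n) aj λ i<l l<j → below (<⇒≤ i<l) l<j

≡ᵇ-reflects-≡ : ∀ m n → Reflects (m ≡ n) (m ≡ᵇ n)
≡ᵇ-reflects-≡ m n = fromEquivalence (≡ᵇ⇒≡ m n) (≡⇒≡ᵇ m n)

-- On [1, K+1], varphiIndex α P K cyclically shifts each of the blocks [α, P] and [P+1, K+1]
-- one step up, and phiIndex α P K shifts them back.
varphiIndex : ℕ → ℕ → ℕ → ℕ → ℕ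
varphiIndex α P K m =
  if m <ᵇ α then m else if m ≡ᵇ P then α else if m ≡ᵇ suc K then suc P
  else if m ≤ᵇ K then suc m else m

phiIndex : ℕ → ℕ → ℕ → ℕ → ℕ
phiIndex α P K m =
  if m <ᵇ α then m else if m ≡ᵇ α then P else if m ≡ᵇ suc P then suc K
  else if m ≤ᵇ suc K then m ∸ 1 else m

record InversePermutations (k : ℕ) (σ τ : ℕ → ℕ) : Set where
  field
    σ-range : ∀ m → 1 ≤ m → m ≤ k → 1 ≤ σ m × σ m ≤ k
    τ-range : ∀ m → 1 ≤ m → m ≤ k → 1 ≤ τ m × τ m ≤ k
    σ∘τ     : ∀ m → 1 ≤ m → m ≤ k → σ (τ m) ≡ m
    τ∘σ     : ∀ m → 1 ≤ m → m ≤ k → τ (σ m) ≡ m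

InversePermutations-sym : ∀ {k σ τ} → InversePermutations k σ τ → InversePermutations k τ σ
InversePermutations-sym π = record { σ-range = τ-range ; τ-range = σ-range ; σ∘τ = τ∘σ ; τ∘σ = σ∘τ }
  where open InversePermutations π

InversePermutations-id : ∀ k → InversePermutations k id id
InversePermutations-id k = record
  { σ-range = λ _ 1≤m m≤k → 1≤m , m≤k ; τ-range = λ _ 1≤m m≤k → 1≤m , m≤k
  ; σ∘τ = λ _ _ _ → refl ; τ∘σ = λ _ _ _ → refl }

module IndexMaps {α P K : ℕ} (1≤α : 1 ≤ α) (α≤P : α ≤ P) (P≤K : P ≤ K) where

  data VarphiIndexView (m : ℕ) : ℕ → Set where
    below : m < α → VarphiIndexView m m
    top   : α ≤ m → m ≡ P → VarphiIndexView m α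
    last  : α ≤ m → m ≢ P → m ≡ suc K → VarphiIndexView m (suc P)
    shift : α ≤ m → m ≢ P → m ≤ K → VarphiIndexView m (suc m)

  varphiIndex-view : ∀ m → m ≤ suc K → VarphiIndexView m (varphiIndex α P K m)
  varphiIndex-view m m≤1+K with m <ᵇ α | <ᵇ-reflects-< m α
  ... | true  | ofʸ m<α = below m<α
  ... | false | ofⁿ m≮α with m ≡ᵇ P | ≡ᵇ-reflects-≡ m P
  ... | true  | ofʸ m≡P = top (≮⇒≥ m≮α) m≡P
  ... | false | ofⁿ m≢P with m ≡ᵇ suc K | ≡ᵇ-reflects-≡ m (suc K)
  ... | true  | ofʸ m≡1+K = last (≮⇒≥ m≮α) m≢P m≡1+K
  ... | false | ofⁿ m≢1+K with m ≤ᵇ K | ≤ᵇ-reflects-≤ m K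
  ... | true  | ofʸ m≤K = shift (≮⇒≥ m≮α) m≢P m≤K
  ... | false | ofⁿ m≰K = ⊥-elim (m≢1+K (≤-antisym m≤1+K (≰⇒> m≰K)))

  data PhiIndexView (m : ℕ) : ℕ → Set where
    below : m < α → PhiIndexView m m
    first : m ≡ α → PhiIndexView m P
    top   : α < m → m ≡ suc P → PhiIndexView m (suc K)
    shift : ∀ {l} → α < m → m ≢ suc P → m ≡ suc l → l ≤ K → PhiIndexView m l

  phiIndex-view : ∀ m → m ≤ suc K → PhiIndexView m (phiIndex α P K m)
  phiIndex-view m m≤1+K with m <ᵇ α | <ᵇ-reflects-< m α
  ... | true  | ofʸ m<α = below m<α
  ... | false | ofⁿ m≮α with m ≡ᵇ α | ≡ᵇ-reflects-≡ m α
  ... | true  | ofʸ m≡α = first m≡α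
  ... | false | ofⁿ m≢α with m ≡ᵇ suc P | ≡ᵇ-reflects-≡ m (suc P)
  ... | true  | ofʸ m≡1+P = top (≤∧≢⇒< (≮⇒≥ m≮α) (m≢α ∘ sym)) m≡1+P
  ... | false | ofⁿ m≢1+P with m ≤ᵇ suc K | ≤ᵇ-reflects-≤ m (suc K)
  ... | false | ofⁿ m≰1+K = ⊥-elim (m≰1+K m≤1+K)
  ... | true  | ofʸ _ with m | ≤∧≢⇒< (≮⇒≥ m≮α) (m≢α ∘ sym)
  ...   | suc l | α<m = shift α<m m≢1+P refl (≤-pred m≤1+K)

  private
    P≤1+K : P ≤ suc K
    P≤1+K = m≤n⇒m≤1+n P≤K

    α≤1+K : α ≤ suc K
    α≤1+K = ≤-trans α≤P P≤1+K

  varphiIndex-below : ∀ {m} → m < α → varphiIndex α P K m ≡ m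
  varphiIndex-below {m} m<α rewrite det (<ᵇ-reflects-< m α) (ofʸ m<α) = refl

  varphiIndex-P : varphiIndex α P K P ≡ α
  varphiIndex-P
    rewrite det (<ᵇ-reflects-< P α) (ofⁿ (≤⇒≯ α≤P)) | det (≡ᵇ-reflects-≡ P P) (ofʸ refl) = refl

  varphiIndex-1+K : varphiIndex α P K (suc K) ≡ suc P
  varphiIndex-1+K
    rewrite det (<ᵇ-reflects-< (suc K) α) (ofⁿ (≤⇒≯ α≤1+K))
          | det (≡ᵇ-reflects-≡ (suc K) P) (ofⁿ (>⇒≢ (s≤s P≤K)))
          | det (≡ᵇ-reflects-≡ (suc K) (suc K)) (ofʸ refl) = refl

  varphiIndex-shift : ∀ {l} → α ≤ l → l ≤ K → l ≢ P → varphiIndex α P K l ≡ suc l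
  varphiIndex-shift {l} α≤l l≤K l≢P
    rewrite det (<ᵇ-reflects-< l α) (ofⁿ (≤⇒≯ α≤l))
          | det (≡ᵇ-reflects-≡ l P) (ofⁿ l≢P)
          | det (≡ᵇ-reflects-≡ l (suc K)) (ofⁿ (<⇒≢ (s≤s l≤K)))
          | det (≤ᵇ-reflects-≤ l K) (ofʸ l≤K) = refl

  phiIndex-below : ∀ {m} → m < α → phiIndex α P K m ≡ m
  phiIndex-below {m} m<α rewrite det (<ᵇ-reflects-< m α) (ofʸ m<α) = refl

  phiIndex-α : phiIndex α P K α ≡ P
  phiIndex-α
    rewrite det (<ᵇ-reflects-< α α) (ofⁿ (<-irrefl refl)) | det (≡ᵇ-reflects-≡ α α) (ofʸ refl) = refl

  phiIndex-1+P : phiIndex α P K (suc P) ≡ suc K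
  phiIndex-1+P
    rewrite det (<ᵇ-reflects-< (suc P) α) (ofⁿ (≤⇒≯ (m≤n⇒m≤1+n α≤P)))
          | det (≡ᵇ-reflects-≡ (suc P) α) (ofⁿ (>⇒≢ (s≤s α≤P)))
          | det (≡ᵇ-reflects-≡ (suc P) (suc P)) (ofʸ refl) = refl

  phiIndex-shift : ∀ {l} → α ≤ l → l ≤ K → l ≢ P → phiIndex α P K (suc l) ≡ l
  phiIndex-shift {l} α≤l l≤K l≢P
    rewrite det (<ᵇ-reflects-< (suc l) α) (ofⁿ (≤⇒≯ (m≤n⇒m≤1+n α≤l)))
          | det (≡ᵇ-reflects-≡ (suc l) α) (ofⁿ (>⇒≢ (s≤s α≤l)))
          | det (≡ᵇ-reflects-≡ (suc l) (suc P)) (ofⁿ (l≢P ∘ suc-injective))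
          | det (≤ᵇ-reflects-≤ (suc l) (suc K)) (ofʸ (s≤s l≤K)) = refl

  phiIndex∘varphiIndex : ∀ m → m ≤ suc K → phiIndex α P K (varphiIndex α P K m) ≡ m
  phiIndex∘varphiIndex m m≤1+K with varphiIndex α P K m | varphiIndex-view m m≤1+K
  ... | _ | below m<α         = phiIndex-below m<α
  ... | _ | top _ refl        = phiIndex-α
  ... | _ | last _ _ refl     = phiIndex-1+P
  ... | _ | shift α≤m m≢P m≤K = phiIndex-shift α≤m m≤K m≢P

  varphiIndex∘phiIndex : ∀ m → m ≤ suc K → varphiIndex α P K (phiIndex α P K m) ≡ m
  varphiIndex∘phiIndex m m≤1+K with phiIndex α P K m | phiIndex-view m m≤1+K
  ... | _ | below m<α                = varphiIndex-below m<α
  ... | _ | first refl               = varphiIndex-P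
  ... | _ | top _ refl               = varphiIndex-1+K
  ... | _ | shift α<m m≢1+P refl l≤K = varphiIndex-shift (≤-pred α<m) l≤K (m≢1+P ∘ cong suc)

  varphiIndex-range : ∀ m → 1 ≤ m → m ≤ suc K → 1 ≤ varphiIndex α P K m × varphiIndex α P K m ≤ suc K
  varphiIndex-range m 1≤m m≤1+K with varphiIndex α P K m | varphiIndex-view m m≤1+K
  ... | _ | below _       = 1≤m , m≤1+K
  ... | _ | top _ _       = 1≤α , α≤1+K
  ... | _ | last _ _ _    = s≤s z≤n , s≤s P≤K
  ... | _ | shift _ _ m≤K = s≤s z≤n , s≤s m≤K

  phiIndex-range : ∀ m → 1 ≤ m → m ≤ suc K → 1 ≤ phiIndex α P K m × phiIndex α P K m ≤ suc K
  phiIndex-range m 1≤m m≤1+K with phiIndex α P K m | phiIndex-view m m≤1+K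
  ... | _ | below _            = 1≤m , m≤1+K
  ... | _ | first _            = ≤-trans 1≤α α≤P , P≤1+K
  ... | _ | top _ _            = s≤s z≤n , ≤-refl
  ... | _ | shift α<m _ refl l≤K = ≤-trans 1≤α (≤-pred α<m) , m≤n⇒m≤1+n l≤K

  varphiIndex-inverse : InversePermutations (suc K) (varphiIndex α P K) (phiIndex α P K)
  varphiIndex-inverse = record
    { σ-range = varphiIndex-range
    ; τ-range = phiIndex-range
    ; σ∘τ     = λ m _ → varphiIndex∘phiIndex m
    ; τ∘σ     = λ m _ → phiIndex∘varphiIndex m
    }

  varphiIndex-inversion : ∀ {a b} → a < b → b ≤ suc K → varphiIndex α P K b < varphiIndex α P K a →
    (varphiIndex α P K b ≡ α × α < varphiIndex α P K a × varphiIndex α P K a ≤ P) ⊎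
    (varphiIndex α P K b ≡ suc P × suc P < varphiIndex α P K a × varphiIndex α P K a ≤ suc K)
  varphiIndex-inversion {a} {b} a<b b≤1+K inverted
    with varphiIndex α P K a | varphiIndex-view a (≤-trans (<⇒≤ a<b) b≤1+K)
       | varphiIndex α P K b | varphiIndex-view b b≤1+K
  ... | _ | below _       | _ | below _       = ⊥-elim (<-asym a<b inverted)
  ... | _ | below a<α     | _ | top _ _       = ⊥-elim (<-asym a<α inverted)
  ... | _ | below a<α     | _ | last _ _ _    = ⊥-elim (<-asym (<-≤-trans a<α (m≤n⇒m≤1+n α≤P)) inverted)
  ... | _ | below _       | _ | shift _ _ _   = ⊥-elim (<-asym (m<n⇒m<1+n a<b) inverted)
  ... | _ | top α≤a _     | _ | below b<α     = ⊥-elim (<⇒≱ (<-trans a<b b<α) α≤a)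
  ... | _ | top _ refl    | _ | top _ refl    = ⊥-elim (<-irrefl refl a<b)
  ... | _ | top _ _       | _ | last _ _ _    = ⊥-elim (<⇒≱ inverted (m≤n⇒m≤1+n α≤P))
  ... | _ | top α≤a _     | _ | shift _ _ _   = ⊥-elim (<⇒≱ inverted (m≤n⇒m≤1+n (≤-trans α≤a (<⇒≤ a<b))))
  ... | _ | last _ _ refl | _ | _             = ⊥-elim (<⇒≱ a<b b≤1+K)
  ... | _ | shift α≤a _ _ | _ | below b<α     = ⊥-elim (<⇒≱ (<-trans a<b b<α) α≤a)
  ... | _ | shift α≤a _ _ | _ | top _ refl    = inj₁ (refl , s≤s α≤a , a<b)
  ... | _ | shift _ _ a≤K | _ | last _ _ _    = inj₂ (refl , inverted , s≤s a≤K)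
  ... | _ | shift _ _ _   | _ | shift _ _ _   = ⊥-elim (<-asym (s≤s a<b) inverted)

  phiIndex-inversion : ∀ {a b} → a < b → b ≤ suc K → phiIndex α P K b < phiIndex α P K a →
    (phiIndex α P K a ≡ P × α ≤ phiIndex α P K b × phiIndex α P K b < P) ⊎
    (phiIndex α P K a ≡ suc K × P < phiIndex α P K b × phiIndex α P K b < suc K)
  phiIndex-inversion {a} {b} a<b b≤1+K inverted
    with phiIndex α P K a | phiIndex-view a (≤-trans (<⇒≤ a<b) b≤1+K)
       | phiIndex α P K b | phiIndex-view b b≤1+K
  ... | _ | below _          | _ | below _             = ⊥-elim (<-asym a<b inverted)
  ... | _ | below a<α        | _ | first _             = ⊥-elim (<⇒≱ (<-trans inverted a<α) α≤P)
  ... | _ | below a<α        | _ | top _ _             = ⊥-elim (<⇒≱ (<-trans inverted a<α) (≤-trans α≤P (m≤n⇒m≤1+n P≤K)))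
  ... | _ | below a<α        | _ | shift α<b _ refl _  = ⊥-elim (<⇒≱ (<-trans inverted a<α) (≤-pred α<b))
  ... | _ | first refl       | _ | below b<α           = ⊥-elim (<-asym a<b b<α)
  ... | _ | first refl       | _ | first refl          = ⊥-elim (<-irrefl refl a<b)
  ... | _ | first _          | _ | top _ _             = ⊥-elim (<⇒≱ inverted (m≤n⇒m≤1+n P≤K))
  ... | _ | first _          | _ | shift α<b _ refl _  = inj₁ (refl , ≤-pred α<b , inverted)
  ... | _ | top α<a _        | _ | below b<α           = ⊥-elim (<-asym (<-trans α<a a<b) b<α)
  ... | _ | top α<a _        | _ | first refl          = ⊥-elim (<-asym α<a a<b)
  ... | _ | top _ refl       | _ | top _ refl          = ⊥-elim (<-irrefl refl a<b)
  ... | _ | top _ refl       | _ | shift _ _ refl _    = inj₂ (refl , ≤-pred a<b , inverted)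
  ... | _ | shift α<a _ _ _  | _ | below b<α           = ⊥-elim (<-asym (<-trans α<a a<b) b<α)
  ... | _ | shift α<a _ _ _  | _ | first refl          = ⊥-elim (<-asym α<a a<b)
  ... | _ | shift _ _ _ l≤K  | _ | top _ _             = ⊥-elim (<⇒≱ inverted (m≤n⇒m≤1+n l≤K))
  ... | _ | shift _ _ refl _ | _ | shift _ _ refl _    = ⊥-elim (<-asym (≤-pred a<b) inverted)

rowLen-antitone : ∀ {ls} → Linked _≥_ ls → ∀ {i j} → 1 ≤ i → i ≤ j → rowLen ls j ≤ rowLen ls i
rowLen-antitone []              _         _   = z≤n
rowLen-antitone {_ ∷ _} _ {suc zero} {suc zero}    _ _ = ≤-refl
rowLen-antitone {_ ∷ []} _ {suc zero} {suc (suc j)} _ _ = z≤n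
rowLen-antitone {_ ∷ _ ∷ _} (x≥y ∷ dec) {suc zero} {suc (suc j)} _ _ =
  ≤-trans (rowLen-antitone dec {1} {suc j} (s≤s z≤n) (s≤s z≤n)) x≥y
rowLen-antitone {_ ∷ _} dec {suc (suc i)} {suc (suc j)} _ (s≤s i≤j) =
  rowLen-antitone (Linked.tail dec) (s≤s z≤n) i≤j

module Standard {ls : List ℕ} {k : ℕ} {t : Tab} (syt : SYT ls k t) where

  entry-box : ∀ {m} → 1 ≤ m → m ≤ k → Box ls (t m)
  entry-box = proj₁ syt _

  entry-injective : ∀ {m m′} → 1 ≤ m → m ≤ k → 1 ≤ m′ → m′ ≤ k → R t m ≡ R t m′ → C t m ≡ C t m′ → m ≡ m′
  entry-injective 1≤m m≤k 1≤m′ m′≤k Rm≡ Cm≡ = proj₁ (proj₂ syt) _ _ 1≤m m≤k 1≤m′ m′≤k (cong₂ _,_ Rm≡ Cm≡)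

  row-sorted : ∀ {m m′} → 1 ≤ m → m ≤ k → 1 ≤ m′ → m′ ≤ k → R t m ≡ R t m′ → C t m < C t m′ → m < m′
  row-sorted = proj₁ (proj₂ (proj₂ (proj₂ syt))) _ _

  column-sorted : ∀ {m m′} → 1 ≤ m → m ≤ k → 1 ≤ m′ → m′ ≤ k → C t m ≡ C t m′ → R t m < R t m′ → m < m′
  column-sorted = proj₂ (proj₂ (proj₂ (proj₂ syt))) _ _

  column-sorted-≤ : ∀ {m m′} → 1 ≤ m → m ≤ k → 1 ≤ m′ → m′ ≤ k → C t m ≡ C t m′ → R t m ≤ R t m′ → m ≤ m′
  column-sorted-≤ 1≤m m≤k 1≤m′ m′≤k Cm≡ Rm≤ with m≤n⇒m<n∨m≡n Rm≤
  ... | inj₁ Rm< = <⇒≤ (column-sorted 1≤m m≤k 1≤m′ m′≤k Cm≡ Rm<)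
  ... | inj₂ Rm≡ = ≤-reflexive (entry-injective 1≤m m≤k 1≤m′ m′≤k Rm≡ Cm≡)

  C-<-in-row : ∀ {m m′} → 1 ≤ m → m ≤ k → 1 ≤ m′ → m′ ≤ k → m < m′ → R t m ≡ R t m′ → C t m < C t m′
  C-<-in-row {m} {m′} 1≤m m≤k 1≤m′ m′≤k m<m′ Rm≡ with <-cmp (C t m) (C t m′)
  ... | tri< Cm< _ _ = Cm<
  ... | tri≈ _ Cm≡ _ = ⊥-elim (<-irrefl (entry-injective 1≤m m≤k 1≤m′ m′≤k Rm≡ Cm≡) m<m′)
  ... | tri> _ _ Cm> = ⊥-elim (<-asym m<m′ (row-sorted 1≤m′ m′≤k 1≤m m≤k (sym Rm≡) Cm>))

  R-<-in-column : ∀ {m m′} → 1 ≤ m → m ≤ k → 1 ≤ m′ → m′ ≤ k → m < m′ → C t m ≡ C t m′ → R t m < R t m′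
  R-<-in-column {m} {m′} 1≤m m≤k 1≤m′ m′≤k m<m′ Cm≡ with <-cmp (R t m) (R t m′)
  ... | tri< Rm< _ _ = Rm<
  ... | tri≈ _ Rm≡ _ = ⊥-elim (<-irrefl (entry-injective 1≤m m≤k 1≤m′ m′≤k Rm≡ Cm≡) m<m′)
  ... | tri> _ _ Rm> = ⊥-elim (<-asym m<m′ (column-sorted 1≤m′ m′≤k 1≤m m≤k (sym Cm≡) Rm>))

  SYT-relabel : ∀ {σ τ} → InversePermutations k σ τ →
    (∀ {a b} → 1 ≤ a → a < b → b ≤ k → σ b < σ a → R t (σ a) ≢ R t (σ b) × C t (σ a) ≢ C t (σ b)) →
    ∀ {u} → (∀ m → 1 ≤ m → m ≤ k → u m ≡ t (σ m)) → SYT ls k u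
  SYT-relabel {σ} {τ} π separated {u} u≗tσ = boxes , injective , surjective , rows , columns
    where
    open InversePermutations π

    boxes : ∀ m → 1 ≤ m → m ≤ k → Box ls (u m)
    boxes m 1≤m m≤k rewrite u≗tσ m 1≤m m≤k = entry-box (proj₁ (σ-range m 1≤m m≤k)) (proj₂ (σ-range m 1≤m m≤k))

    injective : ∀ m m′ → 1 ≤ m → m ≤ k → 1 ≤ m′ → m′ ≤ k → u m ≡ u m′ → m ≡ m′
    injective m m′ 1≤m m≤k 1≤m′ m′≤k um≡
      with σ-range m 1≤m m≤k | σ-range m′ 1≤m′ m′≤k
    ... | 1≤σm , σm≤k | 1≤σm′ , σm′≤k = begin
      m         ≡⟨ τ∘σ m 1≤m m≤k ⟨
      τ (σ m)   ≡⟨ cong τ (proj₁ (proj₂ syt) (σ m) (σ m′) 1≤σm σm≤k 1≤σm′ σm′≤k tσm≡) ⟩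
      τ (σ m′)  ≡⟨ τ∘σ m′ 1≤m′ m′≤k ⟩
      m′        ∎
      where
      open ≡-Reasoning
      tσm≡ : t (σ m) ≡ t (σ m′)
      tσm≡ = trans (sym (u≗tσ m 1≤m m≤k)) (trans um≡ (u≗tσ m′ 1≤m′ m′≤k))

    surjective : ∀ b → Box ls b → ∃[ m ] (1 ≤ m × m ≤ k × u m ≡ b)
    surjective b box with proj₁ (proj₂ (proj₂ syt)) b box
    ... | m , 1≤m , m≤k , tm≡b with τ-range m 1≤m m≤k
    ...   | 1≤τm , τm≤k =
      τ m , 1≤τm , τm≤k , trans (u≗tσ (τ m) 1≤τm τm≤k) (trans (cong t (σ∘τ m 1≤m m≤k)) tm≡b)

    unreversed : ∀ {m m′} → 1 ≤ m′ → m ≤ k → σ m < σ m′ →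
      ¬ (R t (σ m′) ≢ R t (σ m) × C t (σ m′) ≢ C t (σ m)) → m < m′
    unreversed {m} {m′} 1≤m′ m≤k σm<σm′ not-separated with <-cmp m m′
    ... | tri< m<m′ _ _ = m<m′
    ... | tri≈ _ refl _ = ⊥-elim (<-irrefl refl σm<σm′)
    ... | tri> _ _ m′<m = ⊥-elim (not-separated (separated 1≤m′ m′<m m≤k σm<σm′))

    rows : ∀ m m′ → 1 ≤ m → m ≤ k → 1 ≤ m′ → m′ ≤ k → R u m ≡ R u m′ → C u m < C u m′ → m < m′
    rows m m′ 1≤m m≤k 1≤m′ m′≤k
      rewrite u≗tσ m 1≤m m≤k | u≗tσ m′ 1≤m′ m′≤k
      with σ-range m 1≤m m≤k | σ-range m′ 1≤m′ m′≤k
    ... | 1≤σm , σm≤k | 1≤σm′ , σm′≤k = λ Rσm≡ Cσm< →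
      unreversed 1≤m′ m≤k (row-sorted 1≤σm σm≤k 1≤σm′ σm′≤k Rσm≡ Cσm<) (λ sep → proj₁ sep (sym Rσm≡))

    columns : ∀ m m′ → 1 ≤ m → m ≤ k → 1 ≤ m′ → m′ ≤ k → C u m ≡ C u m′ → R u m < R u m′ → m < m′
    columns m m′ 1≤m m≤k 1≤m′ m′≤k
      rewrite u≗tσ m 1≤m m≤k | u≗tσ m′ 1≤m′ m′≤k
      with σ-range m 1≤m m≤k | σ-range m′ 1≤m′ m′≤k
    ... | 1≤σm , σm≤k | 1≤σm′ , σm′≤k = λ Cσm≡ Rσm< →
      unreversed 1≤m′ m≤k (column-sorted 1≤σm σm≤k 1≤σm′ σm′≤k Cσm≡ Rσm<) (λ sep → proj₂ sep (sym Cσm≡))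

  SYT-cong : ∀ {u} → (∀ m → u m ≡ t m) → SYT ls k u
  SYT-cong u≗t = SYT-relabel (InversePermutations-id k) (λ _ a<b _ b<a → ⊥-elim (<-asym a<b b<a)) λ m _ _ → u≗t m

  module _ (shape : Linked _≥_ ls) where

    entry-northwest : ∀ {m r c} → 1 ≤ m → m ≤ k → 1 ≤ r → r ≤ R t m → 1 ≤ c → c ≤ C t m →
      ∃[ g ] (1 ≤ g × g ≤ k × R t g ≡ r × C t g ≡ c)
    entry-northwest {m} {r} {c} 1≤m m≤k 1≤r r≤Rm 1≤c c≤Cm
      with proj₁ (proj₂ (proj₂ syt)) (r , c)
             (1≤r , 1≤c , ≤-trans c≤Cm (≤-trans (proj₂ (proj₂ (entry-box 1≤m m≤k))) (rowLen-antitone shape 1≤r r≤Rm)))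
    ... | g , 1≤g , g≤k , tg≡ = g , 1≤g , g≤k , cong proj₁ tg≡ , cong proj₂ tg≡

    -- If J sat below s, the boxes directly under α and under s would share a row, yet be filled
    -- by entries beyond α in the wrong order.
    C-after-crossing≢ : ∀ {α s J} → 1 ≤ α → RowsIncreasing t (suc α) k → α < s → s < J → J ≤ k →
      R t s ≤ R t α → R t α < R t (suc s) → C t J ≢ C t s
    C-after-crossing≢ {α} {s} {J} 1≤α inc α<s s<J J≤k Rs≤Rα Rα<Rs+1 CJ≡Cs =
      under-s (entry-northwest 1≤J J≤k (s≤s z≤n) (RowsIncreasing-< inc α<s s<J J≤k) 1≤Cs (≤-reflexive (sym CJ≡Cs)))
      where
      s≤k : s ≤ k
      s≤k = ≤-trans (<⇒≤ s<J) J≤k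
      1≤s : 1 ≤ s
      1≤s = ≤-trans 1≤α (<⇒≤ α<s)
      1≤J : 1 ≤ J
      1≤J = ≤-trans 1≤s (<⇒≤ s<J)
      α≤k : α ≤ k
      α≤k = ≤-trans (<⇒≤ α<s) s≤k
      1≤Cs : 1 ≤ C t s
      1≤Cs = proj₁ (proj₂ (entry-box 1≤s s≤k))

      under-s : ∃[ g ] (1 ≤ g × g ≤ k × R t g ≡ suc (R t s) × C t g ≡ C t s) → ⊥
      under-s (g , 1≤g , g≤k , Rg , Cg) =
        under-α (entry-northwest 1≤g g≤k (s≤s z≤n) (≤-reflexive (sym Rg)) 1≤Cα (≤-trans (<⇒≤ Cα<Cs) (≤-reflexive (sym Cg))))
        where
        s<g : s < g
        s<g = column-sorted 1≤s s≤k 1≤g g≤k (sym Cg) (≤-reflexive (sym Rg))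
        Rα≡Rs : R t α ≡ R t s
        Rα≡Rs = ≤-antisym (≤-pred (<-≤-trans Rα<Rs+1 (subst (R t (suc s) ≤_) Rg (RowsIncreasing-≤ inc (s≤s (<⇒≤ α<s)) s<g g≤k)))) Rs≤Rα
        Cα<Cs : C t α < C t s
        Cα<Cs = C-<-in-row 1≤α α≤k 1≤s s≤k α<s Rα≡Rs
        1≤Cα : 1 ≤ C t α
        1≤Cα = proj₁ (proj₂ (entry-box 1≤α α≤k))

        under-α : ∃[ f ] (1 ≤ f × f ≤ k × R t f ≡ suc (R t s) × C t f ≡ C t α) → ⊥
        under-α (f , 1≤f , f≤k , Rf , Cf) = <-irrefl (trans Rf (sym Rg)) (RowsIncreasing-< inc α<f f<g g≤k)
          where
          α<f : α < f
          α<f = column-sorted 1≤α α≤k 1≤f f≤k (sym Cf) (subst₂ _<_ (sym Rα≡Rs) (sym Rf) ≤-refl)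
          f<g : f < g
          f<g = row-sorted 1≤f f≤k 1≤g g≤k (trans Rf (sym Rg)) (subst₂ _<_ (sym Cf) (sym Cg) Cα<Cs)

    -- Mirror image: if I sat above P, the boxes directly over P and over K + 1 would share a row,
    -- yet be filled by entries from [α, K] in the wrong order.
    C-before-crossing≢ : ∀ {α K I P} → 1 ≤ α → RowsIncreasing t α K → suc K ≤ k → α ≤ I → I < P → P ≤ K →
      R t (suc K) ≤ R t P → (∀ {J} → α ≤ J → J < P → R t J < R t (suc K)) → C t I ≢ C t P
    C-before-crossing≢ {α} {K} {I} {P} 1≤α inc K<k α≤I I<P P≤K RK+1≤RP before-high CI≡CP =
      over-P (entry-northwest 1≤P P≤k 1≤r pred[n]≤n 1≤CP ≤-refl)
      where
      P≤k : P ≤ k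
      P≤k = ≤-trans P≤K (≤-trans (n≤1+n K) K<k)
      1≤I : 1 ≤ I
      1≤I = ≤-trans 1≤α α≤I
      1≤P : 1 ≤ P
      1≤P = ≤-trans (s≤s z≤n) I<P
      I≤k : I ≤ k
      I≤k = ≤-trans (<⇒≤ I<P) P≤k
      1≤K+1 : 1 ≤ suc K
      1≤K+1 = s≤s z≤n
      RI<RP : R t I < R t P
      RI<RP = RowsIncreasing-< inc α≤I I<P P≤K
      r : ℕ
      r = pred (R t P)
      1+r≡RP : suc r ≡ R t P
      1+r≡RP = suc-pred (R t P) {{>-nonZero (m<n⇒0<n RI<RP)}}
      1≤r : 1 ≤ r
      1≤r = ≤-trans (proj₁ (entry-box 1≤I I≤k)) (<⇒≤pred RI<RP)
      1≤CP : 1 ≤ C t P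
      1≤CP = proj₁ (proj₂ (entry-box 1≤P P≤k))

      over-P : ∃[ g ] (1 ≤ g × g ≤ k × R t g ≡ r × C t g ≡ C t P) → ⊥
      over-P (g , 1≤g , g≤k , Rg , Cg) =
        over-K+1 (entry-northwest 1≤K+1 K<k 1≤r (subst (r ≤_) (sym RK+1≡RP) pred[n]≤n)
                   (proj₁ (proj₂ (entry-box 1≤K+1 K<k))) ≤-refl)
        where
        g<P : g < P
        g<P = column-sorted 1≤g g≤k 1≤P P≤k Cg (subst₂ _<_ (sym Rg) 1+r≡RP ≤-refl)
        I≤g : I ≤ g
        I≤g = column-sorted-≤ 1≤I I≤k 1≤g g≤k (trans CI≡CP (sym Cg)) (subst (R t I ≤_) (sym Rg) (<⇒≤pred RI<RP))
        RK+1≡RP : R t (suc K) ≡ R t P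
        RK+1≡RP = ≤-antisym RK+1≤RP (begin
          R t P       ≡⟨ 1+r≡RP ⟨
          suc r       ≡⟨ cong suc Rg ⟨
          suc (R t g) ≤⟨ before-high (≤-trans α≤I I≤g) g<P ⟩
          R t (suc K) ∎)
          where open ≤-Reasoning
        CP<CK+1 : C t P < C t (suc K)
        CP<CK+1 = C-<-in-row 1≤P P≤k 1≤K+1 K<k (s≤s P≤K) (sym RK+1≡RP)

        over-K+1 : ∃[ g′ ] (1 ≤ g′ × g′ ≤ k × R t g′ ≡ r × C t g′ ≡ C t (suc K)) → ⊥
        over-K+1 (g′ , 1≤g′ , g′≤k , Rg′ , Cg′) =
          <-irrefl (trans Rg (sym Rg′)) (RowsIncreasing-< inc (≤-trans α≤I I≤g) g<g′ g′≤K)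
          where
          g′≤K : g′ ≤ K
          g′≤K = ≤-pred (column-sorted 1≤g′ g′≤k 1≤K+1 K<k Cg′ (subst₂ _<_ (sym Rg′) (trans 1+r≡RP (sym RK+1≡RP)) ≤-refl))
          g<g′ : g < g′
          g<g′ = row-sorted 1≤g g≤k 1≤g′ g′≤k (trans Rg (sym Rg′)) (subst₂ _<_ (sym Cg) (sym Cg′) CP<CK+1)

Chain? : ∀ t n b → Dec (Chain t (suc n) b)
Chain? t n b = chainᵇ t (suc n) b because Chain-reflects t n b

not-both-chains : ∀ {t n a} → ¬ Chain t (suc n) (suc a) ⊎ ¬ Chain t (suc n) a →
  (chainᵇ t (suc n) (suc a) ∧ chainᵇ t (suc n) a) ≡ false
not-both-chains {t} {n} {a} (inj₁ ¬chain) rewrite det (Chain-reflects t n (suc a)) (ofⁿ ¬chain) = refl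
not-both-chains {t} {n} {a} (inj₂ ¬chain) with chainᵇ t (suc n) (suc a)
... | true  = det (Chain-reflects t n a) (ofⁿ ¬chain)
... | false = refl

varphi-fixed : ∀ {ls n α t} → Chain t (suc n) α → Chain t (suc n) (α ∸ 1) → ∀ m → varphi ls (suc n) α t m ≡ t m
varphi-fixed {n = n} {α} {t} chain chain′ m
  rewrite det (Chain-reflects t n α) (ofʸ chain) | det (Chain-reflects t n (α ∸ 1)) (ofʸ chain′) = refl

phi-fixed : ∀ {ls n α t} → Chain t (suc n) α → Chain t (suc n) (α ∸ 1) → ∀ m → phi ls (suc n) α t m ≡ t m
phi-fixed {n = n} {α} {t} chain chain′ m
  rewrite det (Chain-reflects t n α) (ofʸ chain) | det (Chain-reflects t n (α ∸ 1)) (ofʸ chain′) = refl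

varphi-unfold : ∀ {ls h′ a t q′} → ¬ Chain t (suc h′) (suc a) ⊎ ¬ Chain t (suc h′) a →
  maxSat (λ i → R t (i + suc a) ≤ᵇ R t (suc a)) (suc h′) ≡ suc q′ →
  ∀ m → varphi ls (suc h′) (suc a) t m ≡ t (varphiIndex (suc a) (q′ + suc a) (h′ + suc a) m)
varphi-unfold {h′ = h′} {a} {t} {q′} not-both q≡ m rewrite not-both-chains {t} {h′} {a} not-both | q≡
  with m <ᵇ suc a | m ≡ᵇ q′ + suc a | m ≡ᵇ suc (h′ + suc a) | m ≤ᵇ h′ + suc a
... | true  | _     | _     | _     = refl
... | false | true  | _     | _     = refl
... | false | false | true  | _     = refl
... | false | false | false | true  = refl
... | false | false | false | false = refl

phi-unfold : ∀ {ls h′ a t p} → ¬ Chain t (suc h′) (suc a) ⊎ ¬ Chain t (suc h′) a →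
  minFrom (λ i → R t (suc h′ + suc a) ≤ᵇ R t (i + suc a)) 0 (suc h′) ≡ p →
  ∀ m → phi ls (suc h′) (suc a) t m ≡ t (phiIndex (suc a) (p + suc a) (h′ + suc a) m)
phi-unfold {h′ = h′} {a} {t} {p} not-both p≡ m rewrite not-both-chains {t} {h′} {a} not-both | p≡
  with m <ᵇ suc a | m ≡ᵇ suc a | m ≡ᵇ suc (p + suc a) | m ≤ᵇ suc (h′ + suc a)
... | true  | _     | _     | _     = refl
... | false | true  | _     | _     = refl
... | false | false | true  | _     = refl
... | false | false | false | true  = refl
... | false | false | false | false = refl

module VarphiProper {h′ a : ℕ} {ls : List ℕ} (shape : Linked _≥_ ls) {t : Tab}
  (syt : SYT ls (suc h′ + suc a) t) (chain : Chain t (suc h′) (suc a)) (¬chain′ : ¬ Chain t (suc h′) a) where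

  α : ℕ
  α = suc a

  K : ℕ
  K = h′ + α

  k : ℕ
  k = suc K

  u : Tab
  u = varphi ls (suc h′) α t

  open Standard {ls} syt

  increasing : RowsIncreasing t (suc α) k
  increasing = Chain⇒RowsIncreasing chain

  descent : R t (suc α) ≤ R t α
  descent = ≮⇒≥ λ ascent → ¬chain′ (RowsIncreasing⇒Chain
    (RowsIncreasing-⊆ (RowsIncreasing-extendˡ ascent increasing) ≤-refl (s≤s (+-monoʳ-≤ h′ (n≤1+n a)))))

  1≤h′ : 1 ≤ h′
  1≤h′ = n≢0⇒n>0 λ { refl → ¬chain′ [] }

  -- q′ + 1 is the paper's q; φ moves Q = q′ + α into the box of α and h + α into that of Q + 1.
  module Rotation (q′ : ℕ) (q≡ : maxSat (λ i → R t (i + α) ≤ᵇ R t α) (suc h′) ≡ suc q′)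
    (q≤h : suc q′ ≤ suc h′) (last-low : R t (suc (q′ + α)) ≤ R t α)
    (high-after : ∀ {i} → suc q′ < i → i ≤ suc h′ → ¬ R t (i + α) ≤ R t α) where

    Q : ℕ
    Q = q′ + α

    α≤Q : α ≤ Q
    α≤Q = m≤n+m α q′

    Q≤K : Q ≤ K
    Q≤K = +-monoˡ-≤ α (≤-pred q≤h)

    open IndexMaps (s≤s z≤n) α≤Q Q≤K

    σ : ℕ → ℕ
    σ = varphiIndex α Q K

    u≗tσ : ∀ m → u m ≡ t (σ m)
    u≗tσ = varphi-unfold {ls} {h′} {a} {t} (inj₂ ¬chain′) q≡

    next-high : Q < K → R t α < R t (suc (suc Q))
    next-high Q<K = ≰⇒> (high-after ≤-refl (s≤s (+-cancelʳ-< α q′ h′ Q<K)))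

    separated : ∀ {x y} → 1 ≤ x → x < y → y ≤ k → σ y < σ x →
      R t (σ x) ≢ R t (σ y) × C t (σ x) ≢ C t (σ y)
    separated {x} _ x<y y≤k inverted with varphiIndex-inversion x<y y≤k inverted
    ... | inj₁ (σy≡α , α<σx , σx≤Q) rewrite σy≡α =
      <⇒≢ Rσx<Rα , λ Cσx≡Cα → <-asym Rσx<Rα (R-<-in-column (s≤s z≤n) α≤k 1≤σx σx≤k α<σx (sym Cσx≡Cα))
      where
      Rσx<Rα : R t (σ x) < R t α
      Rσx<Rα = <-≤-trans (RowsIncreasing-< increasing α<σx (s≤s σx≤Q) (s≤s Q≤K)) last-low
      α≤k : α ≤ k
      α≤k = ≤-trans α≤Q (m≤n⇒m≤1+n Q≤K)
      1≤σx : 1 ≤ σ x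
      1≤σx = <-trans (s≤s z≤n) α<σx
      σx≤k : σ x ≤ k
      σx≤k = ≤-trans σx≤Q (m≤n⇒m≤1+n Q≤K)
    ... | inj₂ (σy≡1+Q , 1+Q<σx , σx≤k) rewrite σy≡1+Q =
      >⇒≢ (RowsIncreasing-< increasing (s≤s α≤Q) 1+Q<σx σx≤k) ,
      C-after-crossing≢ shape (s≤s z≤n) increasing (s≤s α≤Q) 1+Q<σx σx≤k last-low (next-high (≤-pred (<-≤-trans 1+Q<σx σx≤k)))

    syt-u : SYT ls k u
    syt-u = SYT-relabel varphiIndex-inverse separated λ m _ _ → u≗tσ m

    σ-step : ∀ {m} → α ≤ m → suc m ≤ K → R t (σ m) < R t (σ (suc m))
    σ-step {m} α≤m 1+m≤K with m ≟ Q | suc m ≟ Q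
    ... | yes refl | _
      rewrite varphiIndex-P | varphiIndex-shift (m≤n⇒m≤1+n α≤m) 1+m≤K 1+n≢n = next-high 1+m≤K
    ... | no m≢Q | yes 1+m≡Q = begin-strict
      R t (σ m)       ≡⟨ cong (R t) (varphiIndex-shift α≤m (≤-trans (n≤1+n m) 1+m≤K) m≢Q) ⟩
      R t (suc m)     ≡⟨ cong (R t) 1+m≡Q ⟩
      R t Q           <⟨ step increasing Q (subst (suc α ≤_) 1+m≡Q (s≤s α≤m)) (s≤s Q≤K) ⟩
      R t (suc Q)     ≤⟨ last-low ⟩
      R t α           ≡⟨ cong (R t) varphiIndex-P ⟨
      R t (σ Q)       ≡⟨ cong (R t ∘ σ) 1+m≡Q ⟨
      R t (σ (suc m)) ∎
      where open ≤-Reasoning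
    ... | no m≢Q | no 1+m≢Q
      rewrite varphiIndex-shift α≤m (≤-trans (n≤1+n m) 1+m≤K) m≢Q | varphiIndex-shift (m≤n⇒m≤1+n α≤m) 1+m≤K 1+m≢Q =
      step increasing (suc m) (s≤s α≤m) (s≤s 1+m≤K)

    u-increasing : RowsIncreasing u α K
    u-increasing = rowsIncreasing λ m α≤m 1+m≤K →
      subst₂ _<_ (cong proj₁ (sym (u≗tσ m))) (cong proj₁ (sym (u≗tσ (suc m)))) (σ-step α≤m 1+m≤K)

    u-chain′ : Chain u (suc h′) a
    u-chain′ = RowsIncreasing⇒Chain (RowsIncreasing-⊆ u-increasing ≤-refl (≤-reflexive (sym (+-suc h′ a))))

    Ru-last : R u k ≡ R t (suc Q)
    Ru-last = trans (cong proj₁ (u≗tσ k)) (cong (R t) varphiIndex-1+K)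

    u-descent : R u k ≤ R u K
    u-descent = subst₂ _≤_ (sym Ru-last) (cong proj₁ (sym (u≗tσ K))) σK-high
      where
      σK-high : R t (suc Q) ≤ R t (σ K)
      σK-high with K ≟ Q
      ... | yes K≡Q = begin
        R t (suc Q) ≤⟨ last-low ⟩
        R t α       ≡⟨ cong (R t) varphiIndex-P ⟨
        R t (σ Q)   ≡⟨ cong (R t ∘ σ) K≡Q ⟨
        R t (σ K)   ∎
        where open ≤-Reasoning
      ... | no K≢Q rewrite varphiIndex-shift (≤-trans α≤Q Q≤K) ≤-refl K≢Q =
        RowsIncreasing-≤ increasing (s≤s α≤Q) (s≤s Q≤K) ≤-refl

    ¬u-chain : ¬ Chain u (suc h′) α
    ¬u-chain u-chain = <⇒≱ (step (Chain⇒RowsIncreasing {u} u-chain) K (+-monoˡ-≤ α 1≤h′) ≤-refl) u-descent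

    p≡q′ : minFrom (λ i → R u (suc h′ + α) ≤ᵇ R u (i + α)) 0 (suc h′) ≡ q′
    p≡q′ = minFrom-unique (λ i → ≤ᵇ-reflects-≤ (R u k) (R u (i + α))) (suc h′) z≤n q≤h
      (subst₂ _≤_ (sym Ru-last) (sym (trans (cong proj₁ (u≗tσ Q)) (cong (R t) varphiIndex-P))) last-low)
      below-Q
      where
      below-Q : ∀ {l} → 0 ≤ l → l < q′ → ¬ R u k ≤ R u (l + α)
      below-Q {l} _ l<q′ rewrite Ru-last | u≗tσ (l + α)
        | varphiIndex-shift (m≤n+m α l) (≤-trans (<⇒≤ (+-monoˡ-< α l<q′)) Q≤K) (<⇒≢ (+-monoˡ-< α l<q′)) =
        <⇒≱ (RowsIncreasing-< increasing (s≤s (m≤n+m α l)) (s≤s (+-monoˡ-< α l<q′)) (s≤s Q≤K))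

    phi∘varphi : ∀ m → 1 ≤ m → m ≤ k → phi ls (suc h′) α u m ≡ t m
    phi∘varphi m _ m≤k = begin
      phi ls (suc h′) α u m    ≡⟨ phi-unfold {ls} {h′} {a} {u} (inj₁ ¬u-chain) p≡q′ m ⟩
      u (phiIndex α Q K m)     ≡⟨ u≗tσ (phiIndex α Q K m) ⟩
      t (σ (phiIndex α Q K m)) ≡⟨ cong t (varphiIndex∘phiIndex m m≤k) ⟩
      t m                      ∎
      where open ≡-Reasoning

  varphi-proper : SYTh ls k (suc h′) a u × (∀ m → 1 ≤ m → m ≤ k → phi ls (suc h′) α u m ≡ t m)
  varphi-proper with maxSat-greatest (λ i → ≤ᵇ-reflects-≤ (R t (i + α)) (R t α)) descent (suc h′) (s≤s z≤n)
  ... | q′ , q≡ , q≤h , last-low , high-after = (syt-u , u-chain′) , phi∘varphi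
    where open Rotation q′ q≡ q≤h last-low high-after

module PhiProper {h′ a : ℕ} {ls : List ℕ} (shape : Linked _≥_ ls) {t : Tab}
  (syt : SYT ls (suc h′ + suc a) t) (chain′ : Chain t (suc h′) a) (¬chain : ¬ Chain t (suc h′) (suc a)) where

  α : ℕ
  α = suc a

  K : ℕ
  K = h′ + α

  k : ℕ
  k = suc K

  u : Tab
  u = phi ls (suc h′) α t

  open Standard {ls} syt

  increasing : RowsIncreasing t α K
  increasing = RowsIncreasing-⊆ (Chain⇒RowsIncreasing {t} chain′) ≤-refl (≤-reflexive (+-suc h′ a))

  descent : R t k ≤ R t K
  descent = ≮⇒≥ λ ascent → ¬chain (RowsIncreasing⇒Chain
    (RowsIncreasing-⊆ (RowsIncreasing-extendʳ ascent increasing) (n≤1+n α) ≤-refl))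

  1≤h′ : 1 ≤ h′
  1≤h′ = n≢0⇒n>0 λ { refl → ¬chain [] }

  p : ℕ
  p = minFrom (λ i → R t k ≤ᵇ R t (i + α)) 0 (suc h′)

  module Rotation (p<h : p < suc h′) (first-low : R t k ≤ R t (p + α))
    (high-before : ∀ {l} → 0 ≤ l → l < p → ¬ R t k ≤ R t (l + α)) where

    P : ℕ
    P = p + α

    α≤P : α ≤ P
    α≤P = m≤n+m α p

    P≤K : P ≤ K
    P≤K = +-monoˡ-≤ α (≤-pred p<h)

    open IndexMaps (s≤s z≤n) α≤P P≤K

    ρ : ℕ → ℕ
    ρ = phiIndex α P K

    u≗tρ : ∀ m → u m ≡ t (ρ m)
    u≗tρ = phi-unfold {ls} {h′} {a} {t} (inj₁ ¬chain) refl

    before-high : ∀ {J} → α ≤ J → J < P → R t J < R t k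
    before-high {J} α≤J J<P =
      subst (λ x → R t x < R t k) (m∸n+n≡m α≤J) (≰⇒> (high-before z≤n (+-cancelʳ-< α (J ∸ α) p J∸α+α<P)))
      where
      J∸α+α<P : J ∸ α + α < P
      J∸α+α<P = subst (_< P) (sym (m∸n+n≡m α≤J)) J<P

    separated : ∀ {x y} → 1 ≤ x → x < y → y ≤ k → ρ y < ρ x →
      R t (ρ x) ≢ R t (ρ y) × C t (ρ x) ≢ C t (ρ y)
    separated {x} {y} _ x<y y≤k inverted with phiIndex-inversion x<y y≤k inverted
    ... | inj₁ (ρx≡P , α≤ρy , ρy<P) rewrite ρx≡P =
      >⇒≢ (RowsIncreasing-< increasing α≤ρy ρy<P P≤K) ,
      C-before-crossing≢ shape (s≤s z≤n) increasing ≤-refl α≤ρy ρy<P P≤K first-low before-high ∘ sym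
    ... | inj₂ (ρx≡1+K , P<ρy , ρy<1+K) rewrite ρx≡1+K =
      <⇒≢ Rk<Rρy , λ Ck≡Cρy → <-asym Rk<Rρy (R-<-in-column 1≤ρy (<⇒≤ ρy<1+K) (s≤s z≤n) ≤-refl ρy<1+K (sym Ck≡Cρy))
      where
      Rk<Rρy : R t k < R t (ρ y)
      Rk<Rρy = ≤-<-trans first-low (RowsIncreasing-< increasing α≤P P<ρy (≤-pred ρy<1+K))
      1≤ρy : 1 ≤ ρ y
      1≤ρy = ≤-trans (s≤s z≤n) P<ρy

    syt-u : SYT ls k u
    syt-u = SYT-relabel (InversePermutations-sym varphiIndex-inverse) separated λ m _ _ → u≗tρ m

    ρ-step : ∀ {l} → α ≤ l → suc (suc l) ≤ k → R t (ρ (suc l)) < R t (ρ (suc (suc l)))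
    ρ-step {l} α≤l 2+l≤k with l ≟ P | suc l ≟ P
    ... | yes refl | _
      rewrite phiIndex-1+P | phiIndex-shift (m≤n⇒m≤1+n α≤l) (≤-pred 2+l≤k) 1+n≢n =
      ≤-<-trans first-low (step increasing l α≤l (≤-pred 2+l≤k))
    ... | no l≢P | yes 1+l≡P = begin-strict
      R t (ρ (suc l))       ≡⟨ cong (R t) (phiIndex-shift α≤l (≤-trans (n≤1+n l) (≤-pred 2+l≤k)) l≢P) ⟩
      R t l                 <⟨ before-high α≤l (≤-reflexive 1+l≡P) ⟩
      R t k                 ≡⟨ cong (R t) phiIndex-1+P ⟨
      R t (ρ (suc P))       ≡⟨ cong (R t ∘ ρ ∘ suc) 1+l≡P ⟨
      R t (ρ (suc (suc l))) ∎
      where open ≤-Reasoning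
    ... | no l≢P | no 1+l≢P
      rewrite phiIndex-shift α≤l (≤-trans (n≤1+n l) (≤-pred 2+l≤k)) l≢P
            | phiIndex-shift (m≤n⇒m≤1+n α≤l) (≤-pred 2+l≤k) 1+l≢P =
      step increasing l α≤l (≤-pred 2+l≤k)

    u-step : ∀ m → suc α ≤ m → suc m ≤ k → R u m < R u (suc m)
    u-step (suc l) (s≤s α≤l) 2+l≤k =
      subst₂ _<_ (cong proj₁ (sym (u≗tρ (suc l)))) (cong proj₁ (sym (u≗tρ (suc (suc l))))) (ρ-step α≤l 2+l≤k)

    u-chain : Chain u (suc h′) α
    u-chain = RowsIncreasing⇒Chain (rowsIncreasing {u} u-step)

    Ru-α : R u α ≡ R t P
    Ru-α = trans (cong proj₁ (u≗tρ α)) (cong (R t) phiIndex-α)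

    u-descent : R u (suc α) ≤ R u α
    u-descent = subst₂ _≤_ (cong proj₁ (sym (u≗tρ (suc α)))) (sym Ru-α) ρ[1+α]-low
      where
      ρ[1+α]-low : R t (ρ (suc α)) ≤ R t P
      ρ[1+α]-low with α ≟ P
      ... | yes α≡P = begin
        R t (ρ (suc α)) ≡⟨ cong (R t ∘ ρ ∘ suc) α≡P ⟩
        R t (ρ (suc P)) ≡⟨ cong (R t) phiIndex-1+P ⟩
        R t k           ≤⟨ first-low ⟩
        R t P           ∎
        where open ≤-Reasoning
      ... | no α≢P rewrite phiIndex-shift ≤-refl (≤-trans α≤P P≤K) α≢P =
        RowsIncreasing-≤ increasing ≤-refl α≤P P≤K

    ¬u-chain′ : ¬ Chain u (suc h′) a
    ¬u-chain′ u-chain′ =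
      <⇒≱ (step (Chain⇒RowsIncreasing {u} u-chain′) α ≤-refl (s≤s (+-monoˡ-≤ a 1≤h′))) u-descent

    q≡1+p : maxSat (λ i → R u (i + α) ≤ᵇ R u α) (suc h′) ≡ suc p
    q≡1+p = maxSat-unique (λ i → ≤ᵇ-reflects-≤ (R u (i + α)) (R u α)) (suc h′) (s≤s z≤n) p<h
      (subst₂ _≤_ (sym (trans (cong proj₁ (u≗tρ (suc P))) (cong (R t) phiIndex-1+P))) (sym Ru-α) first-low)
      high-after
      where
      high-after : ∀ {i} → suc p < i → i ≤ suc h′ → ¬ R u (i + α) ≤ R u α
      high-after {suc i} (s≤s p<i) 1+i≤1+h′ rewrite Ru-α | u≗tρ (suc (i + α))
        | phiIndex-shift (m≤n+m α i) (+-monoˡ-≤ α (≤-pred 1+i≤1+h′)) (>⇒≢ (+-monoˡ-< α p<i)) =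
        <⇒≱ (RowsIncreasing-< increasing α≤P (+-monoˡ-< α p<i) (+-monoˡ-≤ α (≤-pred 1+i≤1+h′)))

    varphi∘phi : ∀ m → 1 ≤ m → m ≤ k → varphi ls (suc h′) α u m ≡ t m
    varphi∘phi m _ m≤k = begin
      varphi ls (suc h′) α u m ≡⟨ varphi-unfold {ls} {h′} {a} {u} (inj₂ ¬u-chain′) q≡1+p m ⟩
      u (varphiIndex α P K m)  ≡⟨ u≗tρ (varphiIndex α P K m) ⟩
      t (ρ (varphiIndex α P K m)) ≡⟨ cong t (phiIndex∘varphiIndex m m≤k) ⟩
      t m                      ∎
      where open ≡-Reasoning

  phi-proper : SYTh ls k (suc h′) α u × (∀ m → 1 ≤ m → m ≤ k → varphi ls (suc h′) α u m ≡ t m)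
  phi-proper with minFrom-least (λ i → ≤ᵇ-reflects-≤ (R t k) (R t (i + α))) (suc h′) z≤n ≤-refl descent
  ... | _ , p<h , first-low , high-before = (syt-u , u-chain) , varphi∘phi
    where open Rotation p<h first-low high-before

varphi-inverse : ∀ {h′ a ls t} → Linked _≥_ ls → SYTh ls (suc h′ + suc a) (suc h′) (suc a) t →
  SYTh ls (suc h′ + suc a) (suc h′) a (varphi ls (suc h′) (suc a) t) ×
  (∀ m → 1 ≤ m → m ≤ suc h′ + suc a → phi ls (suc h′) (suc a) (varphi ls (suc h′) (suc a) t) m ≡ t m)
varphi-inverse {h′} {a} {ls} {t} shape (syt , chain) with Chain? t h′ a
... | no ¬chain′ = VarphiProper.varphi-proper shape syt chain ¬chain′
... | yes chain′ =
  (Standard.SYT-cong {ls} syt u≗t , same-chain chain′) ,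
  λ m _ _ → trans (phi-fixed {ls} {h′} {suc a} {u} (same-chain chain) (same-chain chain′) m) (u≗t m)
  where
  u : Tab
  u = varphi ls (suc h′) (suc a) t
  u≗t : ∀ m → u m ≡ t m
  u≗t = varphi-fixed {ls} {h′} {suc a} {t} chain chain′
  same-chain : ∀ {b} → Chain t (suc h′) b → Chain u (suc h′) b
  same-chain = Chain-cong u {suc h′} u≗t

phi-inverse : ∀ {h′ a ls t} → Linked _≥_ ls → SYTh ls (suc h′ + suc a) (suc h′) a t →
  SYTh ls (suc h′ + suc a) (suc h′) (suc a) (phi ls (suc h′) (suc a) t) ×
  (∀ m → 1 ≤ m → m ≤ suc h′ + suc a → varphi ls (suc h′) (suc a) (phi ls (suc h′) (suc a) t) m ≡ t m)
phi-inverse {h′} {a} {ls} {t} shape (syt , chain′) with Chain? t h′ (suc a)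
... | no ¬chain = PhiProper.phi-proper shape syt chain′ ¬chain
... | yes chain =
  (Standard.SYT-cong {ls} syt u≗t , same-chain chain) ,
  λ m _ _ → trans (varphi-fixed {ls} {h′} {suc a} {u} (same-chain chain) (same-chain chain′) m) (u≗t m)
  where
  u : Tab
  u = phi ls (suc h′) (suc a) t
  u≗t : ∀ m → u m ≡ t m
  u≗t = phi-fixed {ls} {h′} {suc a} {t} chain chain′
  same-chain : ∀ {b} → Chain t (suc h′) b → Chain u (suc h′) b
  same-chain = Chain-cong u {suc h′} u≗t

proposition4p7 : (h α : ℕ) → 0 < h → 0 < α → (ls : List ℕ) → IsPartition (h + α) ls →
    ((T : Tab) → SYTh ls (h + α) h α T →
        SYTh ls (h + α) h (α ∸ 1) (varphi ls h α T) ×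
        ((m : ℕ) → 1 ≤ m → m ≤ h + α → phi ls h α (varphi ls h α T) m ≡ T m)) ×
    ((T : Tab) → SYTh ls (h + α) h (α ∸ 1) T →
        SYTh ls (h + α) h α (phi ls h α T) ×
        ((m : ℕ) → 1 ≤ m → m ≤ h + α → varphi ls h α (phi ls h α T) m ≡ T m))
proposition4p7 (suc h′) (suc a) (s≤s z≤n) (s≤s z≤n) ls (shape , _ , _) =
  (λ _ → varphi-inverse shape) , (λ _ → phi-inverse shape)
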